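{- Let $(G,<)$ be an ordering of a graph $G$ and let $X \subseteq V(G)$. Let $d = \max_{u \in V(G)} |N^-(u)|$ be the degeneracy of the ordering and $s_2 = \max_{u \in V(G)} |S^2(u)|$ the strong $2$-colouring number of the ordering. Then (1) $|\operatorname{tr}_G(X)| \leq |X|^d + d\cdot|X| + 1$, and (2) $|\operatorname{tr}_G(X)| \leq |X|\, s_2^d + d \cdot |X| + 1$.
   Context: All graphs are finite, simple and undirected. An ordering of $G$ is a total order $<$ on $V(G)$. For $u \in V(G)$, $N^-(u) = \{v \in N(u) : v < u\}$. The strongly $2$-reachable set of $u$ is $S^2(u) = \{ v \in V(G) : v < u \text{ and either } v \in N(u) \text{ or there is } w \in V(G) \text{ with } u < w,\ w \in N(u),\ v \in N(w)\}$. The trace set of $X$ is $\operatorname{tr}_G(X) = \{X' \subseteq X : \exists y \in V(G) \setminus X \text{ with } N(y) \cap X = X'\}$. -}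

module Defs where

open import Data.Nat using (ℕ; _<_; _<ᵇ_; _⊔_; _+_; _*_; _^_)
open import Data.Bool using (Bool; true; false; _∧_; _∨_; not)
open import Data.Fin using (Fin)
open import Data.Fin.Subset using (Subset; _∩_; ∣_∣; _∈_; _∉_)
open import Data.Fin.Subset.Properties using (_∈?_)
open import Data.Vec using (tabulate; lookup)
open import Data.Vec.Properties using (≡-dec)
open import Data.Bool.Properties using () renaming (_≟_ to _≟ᵇ_)
open import Data.List using (List; length; map; filter; foldr; allFin)
open import Data.Bool.ListAction using (any)
open import Data.List using (deduplicate)
open import Relation.Binary.PropositionalEquality using (_≡_)
open import Relation.Nullary using (¬_; ¬?)
open import Relation.Nullary.Decidable using (⌊_⌋)
open import Function using (Injective)

record Graph (n : ℕ) : Set where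
  field
    adj       : Fin n → Fin n → Bool
    symmetric : ∀ u v → adj u v ≡ adj v u
    irreflex  : ∀ u → adj u u ≡ false
open Graph public

-- An ordering of G: a total order on V(G), given by an injective position map
-- into ℕ;  v < u  iff  pos v < pos u.
record Ordering (n : ℕ) : Set where
  field
    pos    : Fin n → ℕ
    pos-inj : Injective _≡_ _≡_ pos
open Ordering public

module _ {n : ℕ} (G : Graph n) (O : Ordering n) where

  _≺ᵇ_ : Fin n → Fin n → Bool
  v ≺ᵇ u = pos O v <ᵇ pos O u

  N : Fin n → Subset n
  N u = tabulate (adj G u)

  N⁻ : Fin n → Subset n
  N⁻ u = tabulate (λ v → adj G u v ∧ (v ≺ᵇ u))

  S² : Fin n → Subset n
  S² u = tabulate (λ v → (v ≺ᵇ u) ∧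
           (adj G u v ∨ any (λ w → (u ≺ᵇ w) ∧ adj G u w ∧ adj G w v) (allFin n)))

  maxV : (Fin n → ℕ) → ℕ
  maxV f = foldr _⊔_ 0 (map f (allFin n))

  degeneracy : ℕ
  degeneracy = maxV (λ u → ∣ N⁻ u ∣)

  scol2 : ℕ
  scol2 = maxV (λ u → ∣ S² u ∣)

module _ {n : ℕ} (G : Graph n) where

  Nb : Fin n → Subset n
  Nb y = tabulate (adj G y)

  -- tr_G(X) as a duplicate-free list: the distinct sets N(y) ∩ X for y ∉ X
  traceList : Subset n → List (Subset n)
  traceList X = deduplicate (≡-dec _≟ᵇ_)
                  (map (λ y → Nb y ∩ X)
                       (filter (λ y → ¬? (y ∈? X)) (allFin n)))

  traceSize : Subset n → ℕ
  traceSize X = length (traceList X)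

-- Let x be the last vertex of N(y) ∩ X.  If y < x then y ∈ N⁻(x), so at most d·|X|
-- vertices y are of this kind; an empty N(y) ∩ X contributes one trace.  Otherwise
-- x < y, so N(y) ∩ X ⊆ N⁻(y) has at most d elements and is one of at most |X|^d sets
-- of the form {x₁, …, x_d} with xᵢ ∈ X.  Moreover every other z ∈ N(y) ∩ X lies in
-- S²(x), witnessed by y, so N(y) ∩ X = {x} ∪ R with x ∈ X, R ⊆ S²(x) and |R| < d:
-- at most |X| · Σ_{j<d} s₂^j ≤ |X| · s₂^d possibilities, since d ≤ s₂.

module Submission where

open import Defs
open import Data.Nat using (ℕ; zero; suc; _≤_; _<_; _⊔_; _+_; _*_; _^_; _∸_; z≤n; s≤s)
open import Data.Nat.Properties
open import Data.Bool using (Bool; T)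
open import Data.Bool.Properties using (T-≡; T-∧; T-∨) renaming (_≟_ to _≟ᵇ_)
open import Data.Fin using (Fin; zero; suc) renaming (_≟_ to _≟ᶠ_)
open import Data.Fin.Subset using (Subset; inside; outside; ⊥; ⁅_⁆; _∪_; _∩_; _-_; ∣_∣; _∈_; _∉_; _⊆_)
open import Data.Fin.Subset.Properties
  using ( ⊆-antisym; x∈p∪q⁺; x∈p∪q⁻; x∈⁅x⁆; x∈⁅y⁆⇒x≡y; x∈p∧x≢y⇒x∈p-y; p─q⊆p; p∩q⊆p; p∩q⊆q; ∉⊥
        ; p⊆q⇒∣p∣≤∣q∣; x∈p⇒∣p-x∣<∣p∣)
open import Data.Vec using (_∷_; []; here; there; tabulate)
open import Data.Vec.Properties using (lookup∘tabulate; []=⇒lookup; lookup⇒[]=; ≡-dec)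
open import Data.List using (List; []; _∷_; length; map; _++_; concatMap; replicate; allFin)
open import Data.List.Extrema.Nat using (argmax; argmax-sel; f[⊥]≤f[argmax]; f[xs]≤f[argmax])
open import Data.List.Properties
  using (length-++; length-map; length-replicate; length-removeAt′; foldr-preservesᵒ; foldr-preservesᵇ)
open import Data.List.Membership.Propositional using (lose) renaming (_∈_ to _∈ₗ_)
open import Data.List.Membership.Propositional.Properties
  using (∈-map⁺; ∈-map⁻; ∈-++⁺ˡ; ∈-++⁺ʳ; ∈-concatMap⁺; ∈-allFin; ∈-deduplicate⁻)
open import Data.List.Relation.Binary.Subset.Propositional using () renaming (_⊆_ to _⊆ₗ_)
open import Data.List.Relation.Unary.Any as Any using (here; there)
open import Data.List.Relation.Unary.All as All using (All; []; _∷_)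
open import Data.List.Relation.Unary.Any.Properties using (any⁺)
import Data.List.Relation.Unary.All.Properties as All⁺
open import Data.List.Relation.Unary.AllPairs using ([]; _∷_)
open import Data.List.Relation.Unary.Unique.Propositional using (Unique)
import Data.List.Relation.Unary.Unique.DecPropositional.Properties as UniqueDec
open import Data.Product using (_,_; _×_; proj₁; proj₂; ∃-syntax)
open import Data.Sum using (_⊎_; inj₁; inj₂; [_,_]; [_,_]′)
open import Function using (_∘_)
open import Function.Bundles using (Equivalence)
open import Relation.Nullary using (¬_; yes; no; contradiction)
open import Relation.Binary.Definitions using (tri<; tri≈; tri>)
open import Relation.Binary.PropositionalEquality
  using (_≡_; _≢_; refl; sym; trans; subst; cong; cong₂; module ≡-Reasoning)

module _ {A : Set} where

  ∈-─⁺ : ∀ {x y : A} {ys} (x∈ys : x ∈ₗ ys) → y ∈ₗ ys → y ≢ x → y ∈ₗ (ys Any.─ x∈ys)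
  ∈-─⁺ (here refl)  (here refl)  y≢x = contradiction refl y≢x
  ∈-─⁺ (here refl)  (there y∈ys) _   = y∈ys
  ∈-─⁺ (there x∈ys) (here refl)  _   = here refl
  ∈-─⁺ (there x∈ys) (there y∈ys) y≢x = there (∈-─⁺ x∈ys y∈ys y≢x)

  Unique-⊆⇒length≤ : ∀ {xs ys : List A} → Unique xs → xs ⊆ₗ ys → length xs ≤ length ys
  Unique-⊆⇒length≤ [] _ = z≤n
  Unique-⊆⇒length≤ {x ∷ xs} {ys} (x∉xs ∷ xs!) xs⊆ys = begin
    suc (length xs)               ≤⟨ s≤s (Unique-⊆⇒length≤ xs! xs⊆ys─x) ⟩
    suc (length (ys Any.─ x∈ys))  ≡⟨ length-removeAt′ ys (Any.index x∈ys) ⟨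
    length ys                     ∎
    where
    open ≤-Reasoning
    x∈ys : x ∈ₗ ys
    x∈ys = xs⊆ys (here refl)
    xs⊆ys─x : xs ⊆ₗ (ys Any.─ x∈ys)
    xs⊆ys─x y∈xs = ∈-─⁺ x∈ys (xs⊆ys (there y∈xs)) λ { refl → All.lookup x∉xs y∈xs refl }

module _ {A B : Set} where

  length-concatMap≤ : ∀ (f : A → List B) xs {m} → (∀ {x} → x ∈ₗ xs → length (f x) ≤ m) →
                      length (concatMap f xs) ≤ length xs * m
  length-concatMap≤ f []       _  = z≤n
  length-concatMap≤ f (x ∷ xs) fx≤m = begin
    length (f x ++ concatMap f xs)          ≡⟨ length-++ (f x) ⟩
    length (f x) + length (concatMap f xs)  ≤⟨ +-mono-≤ (fx≤m (here refl))
                                                         (length-concatMap≤ f xs (fx≤m ∘ there)) ⟩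
    _                                       ∎
    where open ≤-Reasoning

module _ {A : Set} where

  words : ℕ → List A → List (List A)
  words zero    L = [] ∷ []
  words (suc d) L = concatMap (λ x → map (x ∷_) (words d L)) L

  ∈-words : ∀ {w L} → All (_∈ₗ L) w → w ∈ₗ words (length w) L
  ∈-words []          = here refl
  ∈-words (x∈L ∷ w∈L) = ∈-concatMap⁺ _ (lose x∈L (∈-map⁺ _ (∈-words w∈L)))

  length-words : ∀ d (L : List A) {s} → length L ≤ s → length (words d L) ≤ s ^ d
  length-words zero    L L≤s = ≤-refl
  length-words (suc d) L {s} L≤s = begin
    length (words (suc d) L)       ≤⟨ length-concatMap≤ _ L (λ {x} _ →
                                        ≤-reflexive (length-map (x ∷_) (words d L))) ⟩
    length L * length (words d L)  ≤⟨ *-mono-≤ L≤s (length-words d L L≤s) ⟩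
    s * s ^ d                      ∎
    where open ≤-Reasoning

  wordsBelow : ℕ → List A → List (List A)
  wordsBelow zero    L = []
  wordsBelow (suc d) L = wordsBelow d L ++ words d L

  ∈-wordsBelow : ∀ {d w L} → length w < d → All (_∈ₗ L) w → w ∈ₗ wordsBelow d L
  ∈-wordsBelow {suc d} {w} {L} w<1+d w∈L with m<1+n⇒m<n∨m≡n w<1+d
  ... | inj₁ w<d  = ∈-++⁺ˡ (∈-wordsBelow w<d w∈L)
  ... | inj₂ refl = ∈-++⁺ʳ (wordsBelow (length w) L) (∈-words w∈L)

  -- The sum Σ_{j<d} s^j exceeds s^d only if s ≤ 1 < d.
  length-wordsBelow : ∀ d (L : List A) {s} → d ≤ s → length L ≤ s →
                      length (wordsBelow d L) ≤ s ^ d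
  length-wordsBelow zero          L     _     _   = z≤n
  length-wordsBelow (suc zero)    L {s} 1≤s   _   = ≤-trans 1≤s (≤-reflexive (sym (*-identityʳ s)))
  length-wordsBelow (suc (suc d)) L {s} 2+d≤s L≤s = begin
    length (wordsBelow (suc d) L ++ words (suc d) L)           ≡⟨ length-++ (wordsBelow (suc d) L) ⟩
    length (wordsBelow (suc d) L) + length (words (suc d) L)   ≤⟨ +-mono-≤ (length-wordsBelow (suc d) L (m+n≤o⇒n≤o 1 2+d≤s) L≤s)
                                                                            (length-words (suc d) L L≤s) ⟩
    s ^ suc d + s ^ suc d                                      ≡⟨ cong (s ^ suc d +_) (+-identityʳ (s ^ suc d)) ⟨
    2 * s ^ suc d                                              ≤⟨ *-monoˡ-≤ (s ^ suc d) (≤-trans (s≤s (s≤s z≤n)) 2+d≤s) ⟩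
    s * s ^ suc d                                              ∎
    where open ≤-Reasoning

x∉p-x : ∀ {n} (p : Subset n) x → x ∉ p - x
x∉p-x (_ ∷ p) zero    ()
x∉p-x (_ ∷ p) (suc x) (there x∈p-x) = x∉p-x p x x∈p-x

module _ {n : ℕ} where

  p≡⁅x⁆∪p-x : ∀ {p : Subset n} {x} → x ∈ p → p ≡ ⁅ x ⁆ ∪ (p - x)
  p≡⁅x⁆∪p-x {p} {x} x∈p = ⊆-antisym split join
    where
    split : p ⊆ ⁅ x ⁆ ∪ (p - x)
    split {z} z∈p with z ≟ᶠ x
    ... | yes refl = x∈p∪q⁺ (inj₁ (x∈⁅x⁆ x))
    ... | no  z≢x  = x∈p∪q⁺ (inj₂ (x∈p∧x≢y⇒x∈p-y z∈p z≢x))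
    join : ⁅ x ⁆ ∪ (p - x) ⊆ p
    join z∈ with x∈p∪q⁻ ⁅ x ⁆ (p - x) z∈
    ... | inj₁ z∈⁅x⁆ = subst (_∈ p) (sym (x∈⁅y⁆⇒x≡y x z∈⁅x⁆)) x∈p
    ... | inj₂ z∈p-x = p─q⊆p p ⁅ x ⁆ z∈p-x

  ∈-tabulate⁺ : ∀ {f : Fin n → Bool} {i} → T (f i) → i ∈ tabulate f
  ∈-tabulate⁺ {f} {i} fi = lookup⇒[]= i (tabulate f) (trans (lookup∘tabulate f i) (Equivalence.to T-≡ fi))

  ∈-tabulate⁻ : ∀ {f : Fin n → Bool} {i} → i ∈ tabulate f → T (f i)
  ∈-tabulate⁻ {f} {i} i∈f = Equivalence.from T-≡ (trans (sym (lookup∘tabulate f i)) ([]=⇒lookup i∈f))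

  fromList : List (Fin n) → Subset n
  fromList []      = ⊥
  fromList (x ∷ w) = ⁅ x ⁆ ∪ fromList w

  ∈-fromList⁺ : ∀ {i w} → i ∈ₗ w → i ∈ fromList w
  ∈-fromList⁺ (here refl) = x∈p∪q⁺ (inj₁ (x∈⁅x⁆ _))
  ∈-fromList⁺ (there i∈w) = x∈p∪q⁺ (inj₂ (∈-fromList⁺ i∈w))

  ∈-fromList⁻ : ∀ {i} w → i ∈ fromList w → i ∈ₗ w
  ∈-fromList⁻ []      i∈⊥ = contradiction i∈⊥ ∉⊥
  ∈-fromList⁻ (x ∷ w) i∈  with x∈p∪q⁻ ⁅ x ⁆ (fromList w) i∈
  ... | inj₁ i∈⁅x⁆ = here (x∈⁅y⁆⇒x≡y x i∈⁅x⁆)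
  ... | inj₂ i∈w   = there (∈-fromList⁻ w i∈w)

  fromList-≡ : ∀ {w} {p : Subset n} → All (_∈ p) w → (∀ {i} → i ∈ p → i ∈ₗ w) → fromList w ≡ p
  fromList-≡ {w} w⊆p p⊆w = ⊆-antisym (All.lookup w⊆p ∘ ∈-fromList⁻ w) (∈-fromList⁺ ∘ p⊆w)

elements : ∀ {n} → Subset n → List (Fin n)
elements []            = []
elements (inside ∷ p)  = zero ∷ map suc (elements p)
elements (outside ∷ p) = map suc (elements p)

∈-elements⁺ : ∀ {n} {p : Subset n} {i} → i ∈ p → i ∈ₗ elements p
∈-elements⁺                   here        = here refl
∈-elements⁺ {p = inside  ∷ p} (there i∈p) = there (∈-map⁺ suc (∈-elements⁺ i∈p))
∈-elements⁺ {p = outside ∷ p} (there i∈p) = ∈-map⁺ suc (∈-elements⁺ i∈p)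

∈-elements⁻ : ∀ {n} {p : Subset n} {i} → i ∈ₗ elements p → i ∈ p
∈-elements⁻ {p = inside  ∷ p} (here refl) = here
∈-elements⁻ {p = inside  ∷ p} (there i∈)  with ∈-map⁻ suc i∈
... | j , j∈p , refl = there (∈-elements⁻ j∈p)
∈-elements⁻ {p = outside ∷ p} i∈          with ∈-map⁻ suc i∈
... | j , j∈p , refl = there (∈-elements⁻ j∈p)

length-elements : ∀ {n} (p : Subset n) → length (elements p) ≡ ∣ p ∣
length-elements []            = refl
length-elements (inside  ∷ p) = cong suc (trans (length-map suc (elements p)) (length-elements p))
length-elements (outside ∷ p) = trans (length-map suc (elements p)) (length-elements p)

module _ {n : ℕ} where

  fromList-elements : ∀ (p : Subset n) → fromList (elements p) ≡ p
  fromList-elements p = fromList-≡ (All.tabulate ∈-elements⁻) ∈-elements⁺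

  smallSubsets : ℕ → Subset n → List (Subset n)
  smallSubsets d p = map fromList (words d (elements p))

  -- t is listed by a word of length exactly d: its elements, padded with copies of x.
  ∈-smallSubsets : ∀ {d p t x} → x ∈ t → t ⊆ p → ∣ t ∣ ≤ d → t ∈ₗ smallSubsets d p
  ∈-smallSubsets {d} {p} {t} {x} x∈t t⊆p ∣t∣≤d =
    subst (_∈ₗ smallSubsets d p) (fromList-≡ w⊆t (∈-++⁺ˡ ∘ ∈-elements⁺))
      (∈-map⁺ fromList (subst (λ m → w ∈ₗ words m (elements p)) length-w (∈-words w⊆p)))
    where
    w : List (Fin n)
    w = elements t ++ replicate (d ∸ ∣ t ∣) x
    w⊆t : All (_∈ t) w
    w⊆t = All⁺.++⁺ (All.tabulate ∈-elements⁻) (All⁺.replicate⁺ (d ∸ ∣ t ∣) x∈t)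
    w⊆p : All (_∈ₗ elements p) w
    w⊆p = All.map (∈-elements⁺ ∘ t⊆p) w⊆t
    length-w : length w ≡ d
    length-w = begin
      length w                                                ≡⟨ length-++ (elements t) ⟩
      length (elements t) + length (replicate (d ∸ ∣ t ∣) x)  ≡⟨ cong₂ _+_ (length-elements t) (length-replicate (d ∸ ∣ t ∣)) ⟩
      ∣ t ∣ + (d ∸ ∣ t ∣)                                     ≡⟨ m+[n∸m]≡n ∣t∣≤d ⟩
      d                                                       ∎
      where open ≡-Reasoning

  length-smallSubsets : ∀ d (p : Subset n) → length (smallSubsets d p) ≤ ∣ p ∣ ^ d
  length-smallSubsets d p = begin
    length (smallSubsets d p)      ≡⟨ length-map fromList (words d (elements p)) ⟩
    length (words d (elements p))  ≤⟨ length-words d (elements p) (≤-reflexive (length-elements p)) ⟩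
    ∣ p ∣ ^ d                      ∎
    where open ≤-Reasoning

  pointedSubsets : ℕ → Subset n → (Fin n → Subset n) → List (Subset n)
  pointedSubsets d p S = concatMap (λ x → map (fromList ∘ (x ∷_)) (wordsBelow d (elements (S x)))) (elements p)

  ∈-pointedSubsets : ∀ {d p S x r} → x ∈ p → r ⊆ S x → ∣ r ∣ < d → ⁅ x ⁆ ∪ r ∈ₗ pointedSubsets d p S
  ∈-pointedSubsets {d} {p} {S} {x} {r} x∈p r⊆Sx ∣r∣<d =
    ∈-concatMap⁺ _ (lose (∈-elements⁺ x∈p)
      (subst (_∈ₗ _) (cong (⁅ x ⁆ ∪_) (fromList-elements r))
        (∈-map⁺ (fromList ∘ (x ∷_))
          (∈-wordsBelow (subst (_< d) (sym (length-elements r)) ∣r∣<d)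
                        (All.tabulate (∈-elements⁺ ∘ r⊆Sx ∘ ∈-elements⁻))))))

  length-pointedSubsets : ∀ d (p : Subset n) S {s} → d ≤ s → (∀ x → ∣ S x ∣ ≤ s) →
                          length (pointedSubsets d p S) ≤ ∣ p ∣ * s ^ d
  length-pointedSubsets d p S {s} d≤s ∣S∣≤s = begin
    length (pointedSubsets d p S)  ≤⟨ length-concatMap≤ _ (elements p) length-branch ⟩
    length (elements p) * s ^ d    ≡⟨ cong (_* s ^ d) (length-elements p) ⟩
    ∣ p ∣ * s ^ d                  ∎
    where
    open ≤-Reasoning
    length-branch : ∀ {x} → x ∈ₗ elements p →
                    length (map (fromList ∘ (x ∷_)) (wordsBelow d (elements (S x)))) ≤ s ^ d
    length-branch {x} _ = ≤-trans (≤-reflexive (length-map _ (wordsBelow d (elements (S x)))))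
      (length-wordsBelow d (elements (S x)) d≤s (≤-trans (≤-reflexive (length-elements (S x))) (∣S∣≤s x)))

  ≡⊥⊎argmax : ∀ (f : Fin n → ℕ) (t : Subset n) →
              t ≡ ⊥ ⊎ ∃[ x ] x ∈ t × (∀ {z} → z ∈ t → f z ≤ f x)
  ≡⊥⊎argmax f t with elements t in eq
  ... | []     = inj₁ (trans (sym (fromList-elements t)) (cong fromList eq))
  ... | e ∷ es = inj₂ (argmax f e es , ∈t argmax∈ , λ z∈t → bound (subst (_ ∈ₗ_) eq (∈-elements⁺ z∈t)))
    where
    ∈t : ∀ {z} → z ∈ₗ e ∷ es → z ∈ t
    ∈t z∈ = ∈-elements⁻ (subst (_ ∈ₗ_) (sym eq) z∈)
    argmax∈ : argmax f e es ∈ₗ e ∷ es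
    argmax∈ = [ Any.here , Any.there ]′ (argmax-sel f e es)
    bound : ∀ {z} → z ∈ₗ e ∷ es → f z ≤ f (argmax f e es)
    bound (here refl)  = f[⊥]≤f[argmax] {f = f} e es
    bound (there z∈es) = All.lookup (f[xs]≤f[argmax] {f = f} e es) z∈es

module _ {n : ℕ} (G : Graph n) where

  adj-sym : ∀ {u v} → T (adj G u v) → T (adj G v u)
  adj-sym {u} {v} = subst T (symmetric G u v)

  adj-irrefl : ∀ {u} → ¬ T (adj G u u)
  adj-irrefl {u} = subst T (irreflex G u)

module _ {n : ℕ} (G : Graph n) (O : Ordering n) where

  ≤-maxV : ∀ (f : Fin n → ℕ) u → f u ≤ maxV G O f
  ≤-maxV f u = foldr-preservesᵒ (λ a b → [ m≤n⇒m≤n⊔o b , m≤n⇒m≤o⊔n a ]) 0 (map f (allFin n))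
                 (inj₂ (Any.map ≤-reflexive (∈-map⁺ f (∈-allFin u))))

  maxV-lub : ∀ (f : Fin n → ℕ) {m} → (∀ u → f u ≤ m) → maxV G O f ≤ m
  maxV-lub f {m} f≤m = foldr-preservesᵇ {P = _≤ m} {f = _⊔_} ⊔-lub {xs = map f (allFin n)} z≤n
                         (All⁺.map⁺ (All.tabulate (λ {u} _ → f≤m u)))

  ∈N⁻⁺ : ∀ {u v} → T (adj G u v) → pos O v < pos O u → v ∈ N⁻ G O u
  ∈N⁻⁺ uv v<u = ∈-tabulate⁺ (Equivalence.from T-∧ (uv , <⇒<ᵇ v<u))

  ∈S²⁺ : ∀ {u w v} → pos O u < pos O w → T (adj G u w) → T (adj G w v) → pos O v < pos O u →
         v ∈ S² G O u
  ∈S²⁺ {w = w} u<w uw wv v<u =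
    ∈-tabulate⁺ (Equivalence.from T-∧ (<⇒<ᵇ v<u , Equivalence.from T-∨ (inj₂ (any⁺ _ (lose (∈-allFin w)
      (Equivalence.from T-∧ (<⇒<ᵇ u<w , Equivalence.from T-∧ (uw , wv))))))))

  N⁻⊆S² : ∀ u → N⁻ G O u ⊆ S² G O u
  N⁻⊆S² u {v} v∈N⁻u with Equivalence.to (T-∧ {adj G u v}) (∈-tabulate⁻ v∈N⁻u)
  ... | uv , v<u = ∈-tabulate⁺ (Equivalence.from T-∧ (v<u , Equivalence.from T-∨ (inj₁ uv)))

  ∣N⁻∣≤degeneracy : ∀ u → ∣ N⁻ G O u ∣ ≤ degeneracy G O
  ∣N⁻∣≤degeneracy = ≤-maxV (λ u → ∣ N⁻ G O u ∣)

  ∣S²∣≤scol2 : ∀ u → ∣ S² G O u ∣ ≤ scol2 G O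
  ∣S²∣≤scol2 = ≤-maxV (λ u → ∣ S² G O u ∣)

  degeneracy≤scol2 : degeneracy G O ≤ scol2 G O
  degeneracy≤scol2 = maxV-lub _ (λ u → ≤-trans (p⊆q⇒∣p∣≤∣q∣ (N⁻⊆S² u)) (∣S²∣≤scol2 u))

module _ {n : ℕ} (G : Graph n) (O : Ordering n) (X : Subset n) where

  trace : Fin n → Subset n
  trace y = Nb G y ∩ X

  IsLastIn : Subset n → Fin n → Set
  IsLastIn t x = x ∈ t × (∀ {z} → z ∈ t → pos O z ≤ pos O x)

  CoversBackwardTraces : List (Subset n) → Set
  CoversBackwardTraces C = ∀ {y x} → IsLastIn (trace y) x → pos O x < pos O y → trace y ∈ₗ C

  adj-trace : ∀ {y z} → z ∈ trace y → T (adj G y z)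
  adj-trace {y} {z} z∈ = ∈-tabulate⁻ (p∩q⊆p (Nb G y) X z∈)

  trace⊆X : ∀ y → trace y ⊆ X
  trace⊆X y = p∩q⊆q (Nb G y) X

  forward : List (Fin n)
  forward = concatMap (elements ∘ N⁻ G O) (elements X)

  ∈-forward : ∀ {y x} → x ∈ trace y → pos O y < pos O x → y ∈ₗ forward
  ∈-forward {y} {x} x∈ y<x = ∈-concatMap⁺ _ (lose (∈-elements⁺ (trace⊆X y x∈))
                               (∈-elements⁺ (∈N⁻⁺ G O (adj-sym G (adj-trace x∈)) y<x)))

  length-forward : length forward ≤ degeneracy G O * ∣ X ∣
  length-forward = begin
    length forward                        ≤⟨ length-concatMap≤ _ (elements X) (λ {x} _ →
                                               ≤-trans (≤-reflexive (length-elements (N⁻ G O x))) (∣N⁻∣≤degeneracy G O x)) ⟩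
    length (elements X) * degeneracy G O  ≡⟨ cong (_* degeneracy G O) (length-elements X) ⟩
    ∣ X ∣ * degeneracy G O                ≡⟨ *-comm ∣ X ∣ (degeneracy G O) ⟩
    degeneracy G O * ∣ X ∣                ∎
    where open ≤-Reasoning

  trace∈candidates : ∀ {C} → CoversBackwardTraces C → ∀ y → trace y ∈ₗ C ++ map trace forward ++ ⊥ ∷ []
  trace∈candidates {C} covers y with ≡⊥⊎argmax (pos O) (trace y)
  ... | inj₁ trace≡⊥ = ∈-++⁺ʳ C (∈-++⁺ʳ (map trace forward) (here trace≡⊥))
  ... | inj₂ (x , last@(x∈ , _)) with <-cmp (pos O x) (pos O y)
  ...   | tri< x<y _ _ = ∈-++⁺ˡ (covers last x<y)
  ...   | tri≈ _ x≡y _ = contradiction (subst (T ∘ adj G y) (pos-inj O x≡y) (adj-trace x∈)) (adj-irrefl G)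
  ...   | tri> _ _ y<x = ∈-++⁺ʳ C (∈-++⁺ˡ (∈-map⁺ trace (∈-forward x∈ y<x)))

  traceSize≤ : ∀ C {b} → length C ≤ b → CoversBackwardTraces C →
               traceSize G X ≤ b + degeneracy G O * ∣ X ∣ + 1
  traceSize≤ C {b} C≤b covers = begin
    traceSize G X                                       ≤⟨ Unique-⊆⇒length≤ (UniqueDec.deduplicate-! (≡-dec _≟ᵇ_) _) traceList⊆ ⟩
    length (C ++ map trace forward ++ ⊥ ∷ [])           ≡⟨ length-++ C ⟩
    length C + length (map trace forward ++ ⊥ ∷ [])     ≡⟨ cong (length C +_) (length-++ (map trace forward)) ⟩
    length C + (length (map trace forward) + 1)         ≡⟨ cong (λ m → length C + (m + 1)) (length-map trace forward) ⟩
    length C + (length forward + 1)                     ≤⟨ +-mono-≤ C≤b (+-monoˡ-≤ 1 length-forward) ⟩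
    b + (degeneracy G O * ∣ X ∣ + 1)                    ≡⟨ +-assoc b _ 1 ⟨
    b + degeneracy G O * ∣ X ∣ + 1                      ∎
    where
    open ≤-Reasoning
    traceList⊆ : traceList G X ⊆ₗ C ++ map trace forward ++ ⊥ ∷ []
    traceList⊆ t∈ with ∈-map⁻ trace (∈-deduplicate⁻ (≡-dec _≟ᵇ_) _ t∈)
    ... | y , _ , refl = trace∈candidates covers y

  module _ {y x} (last : IsLastIn (trace y) x) (x<y : pos O x < pos O y) where

    backward-trace⊆N⁻ : trace y ⊆ N⁻ G O y
    backward-trace⊆N⁻ z∈ = ∈N⁻⁺ G O (adj-trace z∈) (≤-<-trans (proj₂ last z∈) x<y)

    ∣backward-trace∣≤degeneracy : ∣ trace y ∣ ≤ degeneracy G O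
    ∣backward-trace∣≤degeneracy = ≤-trans (p⊆q⇒∣p∣≤∣q∣ backward-trace⊆N⁻) (∣N⁻∣≤degeneracy G O y)

    -- y itself is the vertex w in the definition of z ∈ S²(x).
    backward-trace-x⊆S² : trace y - x ⊆ S² G O x
    backward-trace-x⊆S² {z} z∈t-x =
      ∈S²⁺ G O x<y (adj-sym G (adj-trace (proj₁ last))) (adj-trace z∈t) z<x
      where
      z∈t : z ∈ trace y
      z∈t = p─q⊆p (trace y) ⁅ x ⁆ z∈t-x
      z<x : pos O z < pos O x
      z<x = ≤∧≢⇒< (proj₂ last z∈t) (λ eq → x∉p-x (trace y) x (subst (_∈ trace y - x) (pos-inj O eq) z∈t-x))

  covers-smallSubsets : CoversBackwardTraces (smallSubsets (degeneracy G O) X)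
  covers-smallSubsets {y} last x<y =
    ∈-smallSubsets (proj₁ last) (trace⊆X y) (∣backward-trace∣≤degeneracy last x<y)

  covers-pointedSubsets : CoversBackwardTraces (pointedSubsets (degeneracy G O) X (S² G O))
  covers-pointedSubsets {y} {x} last x<y =
    subst (_∈ₗ _) (sym (p≡⁅x⁆∪p-x x∈t))
      (∈-pointedSubsets {S = S² G O} (trace⊆X y x∈t) (backward-trace-x⊆S² last x<y)
        (<-≤-trans (x∈p⇒∣p-x∣<∣p∣ x∈t) (∣backward-trace∣≤degeneracy last x<y)))
    where
    x∈t : x ∈ trace y
    x∈t = proj₁ last

lemma2 : {n : ℕ} (G : Graph n) (O : Ordering n) (X : Subset n) →
    (traceSize G X ≤ ∣ X ∣ ^ degeneracy G O + degeneracy G O * ∣ X ∣ + 1)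
    × (traceSize G X ≤ ∣ X ∣ * scol2 G O ^ degeneracy G O + degeneracy G O * ∣ X ∣ + 1)
lemma2 G O X =
  traceSize≤ G O X (smallSubsets d X) (length-smallSubsets d X) (covers-smallSubsets G O X) ,
  traceSize≤ G O X (pointedSubsets d X (S² G O))
    (length-pointedSubsets d X (S² G O) (degeneracy≤scol2 G O) (∣S²∣≤scol2 G O)) (covers-pointedSubsets G O X)
  where
  d : ℕ
  d = degeneracy G O
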